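{- If $S\subseteq\mathbb{N}^d$ is a quasi-irreducible generalized numerical semigroup, then $\tau(S)\le t(S)\le 2\tau(S)$.
   Context: A GNS is a submonoid $S\subseteq\mathbb{N}^d$ with finite complement $\mathcal{H}(S)=\mathbb{N}^d\setminus S$ (gaps). A relaxed monomial order is a total order $\prec$ on $\mathbb{N}^d$ with $v\prec w\Rightarrow v\prec w+u$ for all $u\in\mathbb{N}^d$ and $0\prec v$ for $v\ne0$. $FA(S)$ is the set of Frobenius allowable gaps (gaps equal to $\max_\prec\mathcal{H}(S)$ for some relaxed monomial order $\prec$), $\tau(S)=|FA(S)|$. $PF(S)=\{P\in\mathcal{H}(S):P+s\in S\ \forall s\in S\setminus\{0\}\}$, $t(S)=|PF(S)|$. $S$ is quasi-irreducible if for every $x\in\mathcal{H}(S)$ either $2x\in FA(S)$ or there is $F\in FA(S)$ with $F-x\in S$. -}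

module Defs where

open import Level using (Level; 0ℓ) renaming (suc to lsuc)
open import Data.Nat using (ℕ; _+_; _*_; _≤_)
open import Data.Vec using (Vec; zipWith; replicate)
open import Data.List using (List; length)
open import Data.List.Membership.Propositional using (_∈_)
open import Data.List.Relation.Unary.Unique.Propositional using (Unique)
open import Data.Product using (Σ; _×_; ∃)
open import Data.Sum using (_⊎_)
open import Relation.Nullary using (¬_; Dec)
open import Relation.Binary.PropositionalEquality using (_≡_; _≢_)
open import Relation.Binary.Structures using (IsStrictTotalOrder)
open import Function.Bundles using (_⇔_)

ℕ^ : ℕ → Set
ℕ^ d = Vec ℕ d

𝟘 : ∀ {d} → ℕ^ d
𝟘 {d} = replicate d 0

_⊕_ : ∀ {d} → ℕ^ d → ℕ^ d → ℕ^ d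
_⊕_ = zipWith _+_

infixl 6 _⊕_

-- A generalized numerical semigroup: a submonoid of ℕ^d with finite
-- complement. The complement is given by a finite list of gaps.
record GNS (d : ℕ) : Set₁ where
  field
    member   : ℕ^ d → Set
    member?  : ∀ x → Dec (member x)
    zero∈    : member 𝟘
    closed   : ∀ x y → member x → member y → member (x ⊕ y)
    gapList  : List (ℕ^ d)
    gapList-correct : ∀ x → (x ∈ gapList) ⇔ (¬ member x)

open GNS public

Gap : ∀ {d} → GNS d → ℕ^ d → Set
Gap S x = ¬ member S x

record IsRelaxedMonomialOrder {d : ℕ} (_≺_ : ℕ^ d → ℕ^ d → Set) : Set where
  field
    isStrictTotalOrder : IsStrictTotalOrder _≡_ _≺_
    compat   : ∀ v w u → v ≺ w → v ≺ (w ⊕ u)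
    positive : ∀ v → v ≢ 𝟘 → 𝟘 ≺ v

IsMaxGap : ∀ {d} → GNS d → (ℕ^ d → ℕ^ d → Set) → ℕ^ d → Set
IsMaxGap S _≺_ F = Gap S F × (∀ h → Gap S h → h ≢ F → h ≺ F)

FA : ∀ {d} → GNS d → ℕ^ d → Set₁
FA {d} S F = Σ (ℕ^ d → ℕ^ d → Set) λ _≺_ →
  IsRelaxedMonomialOrder _≺_ × IsMaxGap S _≺_ F

PF : ∀ {d} → GNS d → ℕ^ d → Set
PF S P = Gap S P × (∀ s → member S s → s ≢ 𝟘 → member S (P ⊕ s))

_-_∈S_ : ∀ {d} → ℕ^ d → ℕ^ d → GNS d → Set
F - x ∈S S = ∃ λ s → member S s × F ≡ x ⊕ s

QuasiIrreducible : ∀ {d} → GNS d → Set₁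
QuasiIrreducible {d} S = ∀ x → Gap S x →
  FA S (x ⊕ x) ⊎ (Σ (ℕ^ d) λ F → FA S F × (F - x ∈S S))

-- A list L enumerates a set P exactly once (so |P| = length L)
Enumerates : ∀ {a} {A : Set} → List A → (A → Set a) → Set a
Enumerates L P = Unique L × (∀ x → (x ∈ L) ⇔ P x)

-- A Frobenius allowable gap F is pseudo-Frobenius: were F + s a gap for some
-- nonzero s ∈ S, it would lie above F = max H(S) in the defining order.
-- Conversely, for P ∈ PF(S) quasi-irreducibility gives 2P ∈ FA(S), or some
-- F ∈ FA(S) with F − P ∈ S; since F is a gap and P + (S∖{0}) ⊆ S, the latter
-- forces F = P. Hence FA(S) ⊆ PF(S) ⊆ FA(S) ∪ ½FA(S), and as doubling is
-- injective, τ(S) ≤ t(S) ≤ 2τ(S).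
module Submission where

open import Defs
open import Level using (0ℓ)
open import Data.Nat using (ℕ; _*_; _≤_; _+_; suc; z≤n; s≤s; ⌊_/2⌋)
open import Data.Nat.Properties
  using (module ≤-Reasoning; _≟_; +-identityʳ; +-cancelˡ-≡; +-suc; +-mono-≤; ≤-trans; n≡⌊n+n/2⌋)
open import Data.Vec using () renaming ([] to []ᵛ; _∷_ to _∷ᵛ_)
open import Data.Vec.Properties using (zipWith-identityʳ; ∷-injective; ≡-dec)
open import Data.List using (List; []; _∷_; length; filter; map)
open import Data.List.Properties using (filter-notAll; length-map)
open import Data.List.Membership.Propositional using (_∈_)
open import Data.List.Membership.Propositional.Properties using (∈-filter⁺; ∈-filter⁻; ∈-map⁻)
import Data.List.Membership.DecPropositional as DecMembership
open import Data.List.Relation.Binary.Subset.Propositional using (_⊆_)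
open import Data.List.Relation.Unary.Unique.Propositional using (Unique)
import Data.List.Relation.Unary.Unique.Propositional.Properties as Unique
open import Data.List.Relation.Unary.All using (lookup)
open import Data.List.Relation.Unary.AllPairs using (_∷_)
open import Data.List.Relation.Unary.Any using (Any; here; there) renaming (map to any-map)
open import Data.Product using (_×_; _,_; proj₁; proj₂)
open import Data.Sum using (_⊎_; inj₁; inj₂) renaming (map to ⊎-map)
open import Data.Empty using (⊥-elim)
open import Function using (_∘_)
open import Function.Bundles using (Equivalence)
open import Function.Definitions using (Injective)
open import Relation.Nullary using (¬_; yes; no; ¬?)
open import Relation.Unary using (Pred; Decidable)
open import Relation.Unary.Properties using (∁?)
open import Relation.Binary.Definitions using (DecidableEquality)
open import Relation.Binary.PropositionalEquality
  using (_≡_; _≢_; refl; sym; trans; cong; cong₂; subst)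
open import Relation.Binary.Structures using (IsStrictTotalOrder)

length-filter+filter-∁ : ∀ {A : Set} {P : Pred A 0ℓ} (P? : Decidable P) (xs : List A) →
  length xs ≡ length (filter P? xs) + length (filter (∁? P?) xs)
length-filter+filter-∁ P? [] = refl
length-filter+filter-∁ P? (x ∷ xs) with P? x
... | yes _ = cong suc (length-filter+filter-∁ P? xs)
... | no _ = trans (cong suc (length-filter+filter-∁ P? xs)) (sym (+-suc _ _))

module _ {A : Set} (_≟ᴬ_ : DecidableEquality A) where

  open DecMembership _≟ᴬ_ using (_∈?_)

  Unique-⊆⇒length≤ : ∀ {xs ys : List A} → Unique xs → xs ⊆ ys → length xs ≤ length ys
  Unique-⊆⇒length≤ {[]} _ _ = z≤n
  Unique-⊆⇒length≤ {x ∷ xs} {ys} (x∉xs ∷ xs!) xs⊆ys =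
    ≤-trans (s≤s (Unique-⊆⇒length≤ xs! xs⊆ys−x)) (filter-notAll (¬? ∘ (x ≟ᴬ_)) ys x∈ys)
    where
    xs⊆ys−x : xs ⊆ filter (¬? ∘ (x ≟ᴬ_)) ys
    xs⊆ys−x z∈xs = ∈-filter⁺ (¬? ∘ (x ≟ᴬ_)) (xs⊆ys (there z∈xs)) (lookup x∉xs z∈xs)
    x∈ys : Any (λ y → ¬ x ≢ y) ys
    x∈ys = any-map (λ x≡y x≢y → x≢y x≡y) (xs⊆ys (here refl))

  Unique-⊆∪preimage⇒length≤2* : ∀ {xs ys : List A} {f : A → A} → Injective _≡_ _≡_ f →
    Unique ys → (∀ {y} → y ∈ ys → y ∈ xs ⊎ f y ∈ xs) → length ys ≤ 2 * length xs
  Unique-⊆∪preimage⇒length≤2* {xs} {ys} {f} f-inj ys! cover = begin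
    length ys                          ≡⟨ length-filter+filter-∁ (_∈? xs) ys ⟩
    length inside + length outside     ≡⟨ cong (length inside +_) (sym (length-map f outside)) ⟩
    length inside + length (map f outside)
      ≤⟨ +-mono-≤ (Unique-⊆⇒length≤ (Unique.filter⁺ _ ys!) inside⊆xs)
                   (Unique-⊆⇒length≤ (Unique.map⁺ f-inj (Unique.filter⁺ _ ys!)) f[outside]⊆xs) ⟩
    length xs + length xs              ≡⟨ cong (length xs +_) (sym (+-identityʳ (length xs))) ⟩
    2 * length xs                      ∎
    where
    open ≤-Reasoning
    inside outside : List A
    inside = filter (_∈? xs) ys
    outside = filter (∁? (_∈? xs)) ys
    inside⊆xs : inside ⊆ xs
    inside⊆xs = proj₂ ∘ ∈-filter⁻ (_∈? xs) {xs = ys}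
    f[outside]⊆xs : map f outside ⊆ xs
    f[outside]⊆xs fy∈ with ∈-map⁻ f fy∈
    ... | y , y∈outside , refl with ∈-filter⁻ (∁? (_∈? xs)) {xs = ys} y∈outside
    ...   | y∈ys , y∉xs with cover y∈ys
    ...     | inj₁ y∈xs = ⊥-elim (y∉xs y∈xs)
    ...     | inj₂ fy∈xs = fy∈xs

⊕-identityʳ : ∀ {d} (x : ℕ^ d) → x ⊕ 𝟘 ≡ x
⊕-identityʳ = zipWith-identityʳ +-identityʳ

⊕-cancelˡ : ∀ {d} (x : ℕ^ d) {y z : ℕ^ d} → x ⊕ y ≡ x ⊕ z → y ≡ z
⊕-cancelˡ []ᵛ {[]ᵛ} {[]ᵛ} _ = refl
⊕-cancelˡ (a ∷ᵛ x) {b ∷ᵛ y} {c ∷ᵛ z} eq =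
  let a+b≡a+c , x⊕y≡x⊕z = ∷-injective eq
  in cong₂ _∷ᵛ_ (+-cancelˡ-≡ a b c a+b≡a+c) (⊕-cancelˡ x x⊕y≡x⊕z)

x⊕y≡x⇒y≡𝟘 : ∀ {d} (x y : ℕ^ d) → x ⊕ y ≡ x → y ≡ 𝟘
x⊕y≡x⇒y≡𝟘 x y eq = ⊕-cancelˡ x (trans eq (sym (⊕-identityʳ x)))

x⊕x-injective : ∀ {d} → Injective _≡_ _≡_ (λ (x : ℕ^ d) → x ⊕ x)
x⊕x-injective {x = []ᵛ} {[]ᵛ} _ = refl
x⊕x-injective {x = a ∷ᵛ x} {b ∷ᵛ y} eq =
  let a+a≡b+b , x⊕x≡y⊕y = ∷-injective eq
  in cong₂ _∷ᵛ_ (halve a+a≡b+b) (x⊕x-injective x⊕x≡y⊕y)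
  where
  halve : a + a ≡ b + b → a ≡ b
  halve a+a≡b+b = trans (n≡⌊n+n/2⌋ a) (trans (cong ⌊_/2⌋ a+a≡b+b) (sym (n≡⌊n+n/2⌋ b)))

FA⇒PF : ∀ {d} (S : GNS d) {F : ℕ^ d} → FA S F → PF S F
FA⇒PF S {F} (_≺_ , ≺-relaxed , F-gap , F-max) = F-gap , F⊕s∈S
  where
  open IsRelaxedMonomialOrder ≺-relaxed
  F⊕s∈S : ∀ s → member S s → s ≢ 𝟘 → member S (F ⊕ s)
  F⊕s∈S s _ s≢𝟘 with member? S (F ⊕ s)
  ... | yes F⊕s∈S = F⊕s∈S
  ... | no F⊕s-gap = ⊥-elim (IsStrictTotalOrder.irrefl isStrictTotalOrder refl
         (compat (F ⊕ s) F s (F-max (F ⊕ s) F⊕s-gap (s≢𝟘 ∘ x⊕y≡x⇒y≡𝟘 F s))))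

quasiIrreducible-PF⇒FA⊎FA-double : ∀ {d} (S : GNS d) → QuasiIrreducible S →
  ∀ {P} → PF S P → FA S P ⊎ FA S (P ⊕ P)
quasiIrreducible-PF⇒FA⊎FA-double S qi {P} (P-gap , P-pf) with qi P P-gap
... | inj₁ 2P∈FA = inj₂ 2P∈FA
... | inj₂ (F , F∈FA , s , s∈S , F≡P⊕s) with ≡-dec _≟_ s 𝟘
...   | yes refl = inj₁ (subst (FA S) (trans F≡P⊕s (⊕-identityʳ P)) F∈FA)
...   | no s≢𝟘 = ⊥-elim (proj₁ (proj₂ (proj₂ F∈FA))
                   (subst (member S) (sym F≡P⊕s) (P-pf s s∈S s≢𝟘)))

corollary3p4 : ∀ {d : ℕ} (S : GNS d) → QuasiIrreducible S →
    (LFA LPF : List (ℕ^ d)) → Enumerates LFA (FA S) → Enumerates LPF (PF S) →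
    (length LFA ≤ length LPF) × (length LPF ≤ 2 * length LFA)
corollary3p4 {d} S qi LFA LPF (LFA! , LFA↔FA) (LPF! , LPF↔PF) =
  Unique-⊆⇒length≤ ≡-ℕ^d LFA! (fromPF ∘ FA⇒PF S ∘ toFA) ,
  Unique-⊆∪preimage⇒length≤2* ≡-ℕ^d x⊕x-injective LPF!
    (⊎-map fromFA fromFA ∘ quasiIrreducible-PF⇒FA⊎FA-double S qi ∘ toPF)
  where
  ≡-ℕ^d : DecidableEquality (ℕ^ d)
  ≡-ℕ^d = ≡-dec _≟_
  open Equivalence
  toFA : ∀ {x} → x ∈ LFA → FA S x
  toFA = to (LFA↔FA _)
  fromFA : ∀ {x} → FA S x → x ∈ LFA
  fromFA = from (LFA↔FA _)
  toPF : ∀ {x} → x ∈ LPF → PF S x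
  toPF = to (LPF↔PF _)
  fromPF : ∀ {x} → PF S x → x ∈ LPF
  fromPF = from (LPF↔PF _)
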